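{- Let $G$ be a finite simple $2$-edge connected graph and let $C$ be a cycle of odd length in $G$. Then every edge $e \in E(G) \setminus E(C)$ is contained in a circuit of even length in $G$.
   Context: Graphs are finite, simple (no loops, no multiple edges). A graph is $2$-edge connected if it is connected and remains connected whenever fewer than $2$ edges are removed. A walk is a sequence $v_0, e_1, v_1, \ldots, e_k, v_k$ of vertices and edges with $e_i$ having endpoints $v_{i-1}, v_i$; a trail is a walk with no repeated edge; a circuit is a trail whose first and last vertices coincide (vertices may repeat). The length of a cycle or circuit is its number of edges; it is even or odd according to this length. -}

module Defs where

open import Data.Nat using (ℕ; suc; _≤_)
open import Data.Fin using (Fin)
open import Data.Bool using (Bool; T)
import Data.Bool
open import Data.Product using (_×_; _,_; Σ; ∃)
open import Data.Sum using (_⊎_)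
open import Data.List using (List; []; _∷_; length)
open import Data.List.Relation.Unary.All using (All)
import Data.List.Relation.Unary.Any
open import Data.List.Relation.Unary.AllPairs using (AllPairs)
open import Relation.Binary.PropositionalEquality using (_≡_)
open import Relation.Nullary using (¬_)

record Graph : Set where
  field
    n     : ℕ
    adj   : Fin n → Fin n → Bool
    sym   : ∀ u v → adj u v ≡ adj v u
    irrefl : ∀ v → adj v v ≡ Data.Bool.false

open Graph public

module _ (G : Graph) where

  V : Set
  V = Fin (n G)

  Adj : V → V → Set
  Adj u v = T (adj G u v)

  -- an (undirected) edge given by an ordered pair of its endpoints
  Edge : Set
  Edge = V × V

  IsEdge : Edge → Set
  IsEdge (u , v) = Adj u v

  SameEdge : Edge → Edge → Set
  SameEdge (a , b) (c , d) = (a ≡ c × b ≡ d) ⊎ (a ≡ d × b ≡ c)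

  data Walk : V → V → Set where
    nil  : ∀ {u} → Walk u u
    cons : ∀ {u v w} → Adj u v → Walk v w → Walk u w

  edges : ∀ {u w} → Walk u w → List Edge
  edges nil = []
  edges (cons {u} {v} _ p) = (u , v) ∷ edges p

  len : ∀ {u w} → Walk u w → ℕ
  len p = length (edges p)

  initVerts : ∀ {u w} → Walk u w → List V
  initVerts nil = []
  initVerts (cons {u} _ p) = u ∷ initVerts p

  IsTrail : ∀ {u w} → Walk u w → Set
  IsTrail p = AllPairs (λ e f → ¬ SameEdge e f) (edges p)

  IsCircuit : ∀ {u} → Walk u u → Set
  IsCircuit p = IsTrail p

  IsCycle : ∀ {u} → Walk u u → Set
  IsCycle p = (3 ≤ len p) × AllPairs (λ x y → ¬ x ≡ y) (initVerts p)

  OnWalk : ∀ {u w} → Edge → Walk u w → Set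
  OnWalk e p = Data.List.Relation.Unary.Any.Any (SameEdge e) (edges p)

  Avoids : ∀ {u w} → Walk u w → Edge → Set
  Avoids p e = All (λ f → ¬ SameEdge e f) (edges p)

  Connected : Set
  Connected = ∀ (u v : V) → Walk u v

  TwoEdgeConnected : Set
  TwoEdgeConnected =
    Connected × (∀ (e : Edge) → IsEdge e → ∀ (u v : V) → Σ (Walk u v) λ p → Avoids p e)

module Submission where

-- Grow a subgraph H of G, starting from the odd cycle C, by adding ears (trails with both ends
-- in H and no edge in H), keeping the invariant that any two vertices of H are joined, for each
-- parity, by a trail of H of that parity. An odd closed trail has this property (the two arcs
-- between two of its vertices have opposite parities), and adding an ear preserves it, because
-- the ear closed up by a trail of H of opposite parity is again an odd closed trail. Since G
-- is 2-edge connected, every edge xw with x in H and w outside H starts an ear. Walking from C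
-- towards e = ab we add ears until one contains e (at the latest the ear starting with ab);
-- closing that ear by a trail of H of the same parity gives an even circuit through e.

open import Defs hiding (sym)
open import Data.Bool.Base using (T)
open import Data.Fin using (_≟_)
open import Data.List.Base using (List; []; _∷_; _++_; [_]; length)
open import Data.List.Properties using (length-++)
open import Data.List.Membership.Propositional using (_∈_)
import Data.List.Membership.Setoid as Membership
open import Data.List.Membership.Setoid.Properties using (∈-resp-≈; All[≉]⇒∉; ∉⇒All[≉])
import Data.List.Relation.Binary.Disjoint.Setoid as Disjointness
import Data.List.Relation.Binary.Permutation.Setoid as Permutation
import Data.List.Relation.Binary.Permutation.Setoid.Properties as PermutationProperties
import Data.List.Relation.Binary.Subset.Propositional as PropositionalSubset
import Data.List.Relation.Binary.Subset.Setoid as SetoidSubset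
import Data.List.Relation.Binary.Subset.Setoid.Properties as SubsetProperties
open import Data.List.Relation.Unary.All as All using (All; []; _∷_)
import Data.List.Relation.Unary.All.Properties as All
open import Data.List.Relation.Unary.Any as Any using (Any; here; there; any?)
import Data.List.Relation.Unary.Any.Properties as Any
open import Data.List.Relation.Unary.AllPairs using ([]; _∷_)
import Data.List.Relation.Unary.AllPairs.Properties as AllPairsProperties
import Data.List.Relation.Unary.Unique.Propositional as PropositionalUnique
import Data.List.Relation.Unary.Unique.Setoid as SetoidUnique
import Data.List.Relation.Unary.Unique.Setoid.Properties as UniqueProperties
open import Data.Nat.Base as ℕ using (zero; suc; _≤_; s≤s; parity)
open import Data.Nat.Divisibility using (_∣_; ∣-refl; ∣m∣n⇒∣m+n; _∣0)
open import Data.Parity.Base using (Parity; 0ℙ; 1ℙ; _⁻¹; _+_)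
open import Data.Parity.Properties using (+-homo-+)
open import Data.Product as Product using (Σ; ∃; _×_; _,_; proj₁; proj₂)
open import Data.Sum as Sum using (_⊎_; inj₁; inj₂)
open import Function using (_∘_; id)
open import Level using (0ℓ)
open import Relation.Binary.Bundles using (Setoid)
open import Relation.Binary.Structures using (IsEquivalence)
open import Relation.Binary.PropositionalEquality
  using (_≡_; refl; cong; cong₂; subst; setoid; sym; trans; module ≡-Reasoning)
open import Relation.Nullary using (¬_; Dec; yes; no; contradiction)
open import Relation.Nullary.Decidable using (_⊎-dec_; _×-dec_)

parity≡0ℙ⇒2∣ : ∀ n → parity n ≡ 0ℙ → 2 ∣ n
parity≡0ℙ⇒2∣ zero          _  = 2 ∣0
parity≡0ℙ⇒2∣ (suc zero)    ()
parity≡0ℙ⇒2∣ (suc (suc n)) eq = ∣m∣n⇒∣m+n ∣-refl (parity≡0ℙ⇒2∣ n eq)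

¬2∣⇒parity≡1ℙ : ∀ n → ¬ 2 ∣ n → parity n ≡ 1ℙ
¬2∣⇒parity≡1ℙ n ¬2∣n with parity n in eq
... | 0ℙ = contradiction (parity≡0ℙ⇒2∣ n eq) ¬2∣n
... | 1ℙ = refl

p+p≡0ℙ : ∀ p → p + p ≡ 0ℙ
p+p≡0ℙ 0ℙ = refl
p+p≡0ℙ 1ℙ = refl

p+p⁻¹≡1ℙ : ∀ p → p + p ⁻¹ ≡ 1ℙ
p+p⁻¹≡1ℙ 0ℙ = refl
p+p⁻¹≡1ℙ 1ℙ = refl

p+[p+q]≡q : ∀ p q → p + (p + q) ≡ q
p+[p+q]≡q 0ℙ q  = refl
p+[p+q]≡q 1ℙ 0ℙ = refl
p+[p+q]≡q 1ℙ 1ℙ = refl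

p+q≡1ℙ⇒p≡r⊎q≡r : ∀ p q r → p + q ≡ 1ℙ → p ≡ r ⊎ q ≡ r
p+q≡1ℙ⇒p≡r⊎q≡r 0ℙ 0ℙ _  ()
p+q≡1ℙ⇒p≡r⊎q≡r 0ℙ 1ℙ 0ℙ _ = inj₁ refl
p+q≡1ℙ⇒p≡r⊎q≡r 0ℙ 1ℙ 1ℙ _ = inj₂ refl
p+q≡1ℙ⇒p≡r⊎q≡r 1ℙ 0ℙ 0ℙ _ = inj₂ refl
p+q≡1ℙ⇒p≡r⊎q≡r 1ℙ 0ℙ 1ℙ _ = inj₁ refl
p+q≡1ℙ⇒p≡r⊎q≡r 1ℙ 1ℙ _  ()

module _ {a ℓ} (S : Setoid a ℓ) where
  open Membership S using (_∈_)
  open SetoidUnique S using (Unique)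
  open Disjointness S using (Disjoint)

  Unique-++⁻ : ∀ xs {ys} → Unique (xs ++ ys) → Unique xs × Unique ys × Disjoint xs ys
  Unique-++⁻ []       u          = [] , u , λ { (() , _) }
  Unique-++⁻ (x ∷ xs) (x≉ ∷ u) with Unique-++⁻ xs u
  ... | uxs , uys , xs#ys = All.++⁻ˡ xs x≉ ∷ uxs , uys , λ where
    (here v≈x   , v∈ys) → All[≉]⇒∉ S (All.++⁻ʳ xs x≉) (∈-resp-≈ S v≈x v∈ys)
    (there v∈xs , v∈ys) → xs#ys (v∈xs , v∈ys)

module _ (G : Graph) where

  private variable
    u v w x y z : V G

  SameEdge-isEquivalence : IsEquivalence (SameEdge G)
  SameEdge-isEquivalence = record
    { refl  = inj₁ (refl , refl)
    ; sym   = λ { (inj₁ (refl , refl)) → inj₁ (refl , refl) ; (inj₂ (refl , refl)) → inj₂ (refl , refl) }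
    ; trans = λ { (inj₁ (refl , refl)) s → s
                ; (inj₂ (refl , refl)) (inj₁ (refl , refl)) → inj₂ (refl , refl)
                ; (inj₂ (refl , refl)) (inj₂ (refl , refl)) → inj₁ (refl , refl) }
    }

  -- Over this setoid, IsTrail G p is Unique (edges G p) and OnWalk G e p is e ∈ edges G p.
  edgeSetoid : Setoid 0ℓ 0ℓ
  edgeSetoid = record { isEquivalence = SameEdge-isEquivalence }

  open Setoid edgeSetoid using () renaming (refl to ≈-refl)
  open Membership edgeSetoid using () renaming (_∈_ to _∈ᴱ_; _∉_ to _∉ᴱ_)
  open SetoidSubset edgeSetoid using () renaming (_⊆_ to _⊆ᴱ_)
  open Disjointness edgeSetoid using (Disjoint)
  open Permutation edgeSetoid using (_↭_; prep; ↭-sym; ↭-reflexive)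
  open PermutationProperties edgeSetoid using (∷↭∷ʳ; ++-comm; Unique-resp-↭; ∈-resp-↭; xs↭ys⇒|xs|≡|ys|)
  open SubsetProperties using (xs⊆xs++ys; xs⊆ys++xs; ∷⁺ʳ)
  open PropositionalSubset using () renaming (_⊆_ to _⊆ⱽ_)
  open import Data.List.Membership.DecPropositional (_≟_ {n G}) using (_∈?_)

  SameEdge-swap : SameEdge G (u , v) (v , u)
  SameEdge-swap = inj₂ (refl , refl)

  SameEdge? : ∀ e f → Dec (SameEdge G e f)
  SameEdge? (a , b) (c , d) = ((a ≟ c) ×-dec (b ≟ d)) ⊎-dec ((a ≟ d) ×-dec (b ≟ c))

  _∈ᴱ?_ : ∀ e es → Dec (e ∈ᴱ es)
  e ∈ᴱ? es = any? (SameEdge? e) es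

  ∷-disjoint : ∀ {e es fs} → e ∉ᴱ fs → Disjoint es fs → Disjoint (e ∷ es) fs
  ∷-disjoint e∉fs es#fs (here f≈e   , f∈fs) = e∉fs (∈-resp-≈ edgeSetoid f≈e f∈fs)
  ∷-disjoint e∉fs es#fs (there f∈es , f∈fs) = es#fs (f∈es , f∈fs)

  _∈ⱽ_ : V G → List (Edge G) → Set
  x ∈ⱽ es = Any (λ f → x ≡ proj₁ f ⊎ x ≡ proj₂ f) es

  _∈ⱽ?_ : ∀ x es → Dec (x ∈ⱽ es)
  x ∈ⱽ? es = any? (λ f → (x ≟ proj₁ f) ⊎-dec (x ≟ proj₂ f)) es

  ∈ᴱ⇒proj₁∈ⱽ : ∀ {e es} → e ∈ᴱ es → proj₁ e ∈ⱽ es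
  ∈ᴱ⇒proj₁∈ⱽ = Any.map λ { (inj₁ (eq , _)) → inj₁ eq ; (inj₂ (eq , _)) → inj₂ eq }

  ∈ᴱ⇒proj₂∈ⱽ : ∀ {e es} → e ∈ᴱ es → proj₂ e ∈ⱽ es
  ∈ᴱ⇒proj₂∈ⱽ = Any.map λ { (inj₁ (_ , eq)) → inj₂ eq ; (inj₂ (_ , eq)) → inj₁ eq }

  infixr 5 _++ʷ_

  _++ʷ_ : Walk G u v → Walk G v w → Walk G u w
  nil      ++ʷ q = q
  cons a p ++ʷ q = cons a (p ++ʷ q)

  edges-++ʷ : (p : Walk G u v) (q : Walk G v w) → edges G (p ++ʷ q) ≡ edges G p ++ edges G q
  edges-++ʷ nil        q = refl
  edges-++ʷ (cons a p) q = cong (_ ∷_) (edges-++ʷ p q)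

  ⊆-++ʷˡ : (p : Walk G u v) (q : Walk G v w) → edges G p ⊆ᴱ edges G (p ++ʷ q)
  ⊆-++ʷˡ p q = subst (edges G p ⊆ᴱ_) (sym (edges-++ʷ p q)) (xs⊆xs++ys edgeSetoid (edges G p) (edges G q))

  ⊆-++ʷʳ : (p : Walk G u v) (q : Walk G v w) → edges G q ⊆ᴱ edges G (p ++ʷ q)
  ⊆-++ʷʳ p q = subst (edges G q ⊆ᴱ_) (sym (edges-++ʷ p q)) (xs⊆ys++xs edgeSetoid (edges G q) (edges G p))

  ++ʷ-⊆ : ∀ {es fs} (p : Walk G u v) (q : Walk G v w) → edges G p ⊆ᴱ es → edges G q ⊆ᴱ fs →
          edges G (p ++ʷ q) ⊆ᴱ es ++ fs
  ++ʷ-⊆ p q p⊆es q⊆fs = subst (_⊆ᴱ _) (sym (edges-++ʷ p q)) (SubsetProperties.++⁺ edgeSetoid p⊆es q⊆fs)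

  ++ʷ-trail : (p : Walk G u v) (q : Walk G v w) → IsTrail G p → IsTrail G q →
              Disjoint (edges G p) (edges G q) → IsTrail G (p ++ʷ q)
  ++ʷ-trail p q tp tq p#q =
    subst (SetoidUnique.Unique edgeSetoid) (sym (edges-++ʷ p q)) (UniqueProperties.++⁺ edgeSetoid tp tq p#q)

  ++ʷ-trail⁻ : (p : Walk G u v) (q : Walk G v w) → IsTrail G (p ++ʷ q) →
               IsTrail G p × IsTrail G q × Disjoint (edges G p) (edges G q)
  ++ʷ-trail⁻ p q t = Unique-++⁻ edgeSetoid (edges G p) (subst (SetoidUnique.Unique edgeSetoid) (edges-++ʷ p q) t)

  parityʷ : Walk G u v → Parity
  parityʷ p = parity (len G p)

  parityʷ-++ʷ : (p : Walk G u v) (q : Walk G v w) → parityʷ (p ++ʷ q) ≡ parityʷ p + parityʷ q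
  parityʷ-++ʷ p q = begin
    parity (len G (p ++ʷ q))                    ≡⟨ cong (parity ∘ length) (edges-++ʷ p q) ⟩
    parity (length (edges G p ++ edges G q))    ≡⟨ cong parity (length-++ (edges G p)) ⟩
    parity (len G p ℕ.+ len G q)                ≡⟨ +-homo-+ (len G p) (len G q) ⟩
    parityʷ p + parityʷ q                       ∎
    where open ≡-Reasoning

  parityʷ-↭ : (p : Walk G u v) (q : Walk G x y) → edges G p ↭ edges G q → parityʷ p ≡ parityʷ q
  parityʷ-↭ p q p↭q = cong parity (xs↭ys⇒|xs|≡|ys| p↭q)

  Adj-sym : Adj G u v → Adj G v u
  Adj-sym {u} {v} = subst T (Graph.sym G u v)

  reverseʷ : Walk G u v → Walk G v u
  reverseʷ nil        = nil
  reverseʷ (cons a p) = reverseʷ p ++ʷ cons (Adj-sym a) nil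

  edges-reverseʷ : (p : Walk G u v) → edges G (reverseʷ p) ↭ edges G p
  edges-reverseʷ nil = ↭-reflexive refl
  edges-reverseʷ (cons {u} {v} a p) = begin
    edges G (reverseʷ p ++ʷ cons (Adj-sym a) nil) ≡⟨ edges-++ʷ (reverseʷ p) _ ⟩
    edges G (reverseʷ p) ++ [ (v , u) ]           ↭⟨ ↭-sym (∷↭∷ʳ _ _) ⟩
    (v , u) ∷ edges G (reverseʷ p)                ↭⟨ prep SameEdge-swap (edges-reverseʷ p) ⟩
    (u , v) ∷ edges G p                           ∎
    where open Permutation.PermutationReasoning edgeSetoid

  reverseʷ-trail : (p : Walk G u v) → IsTrail G p → IsTrail G (reverseʷ p)
  reverseʷ-trail p = Unique-resp-↭ (↭-sym (edges-reverseʷ p))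

  vertices : Walk G u v → List (V G)
  vertices {u} nil        = [ u ]
  vertices {u} (cons _ p) = u ∷ vertices p

  start∈vertices : (p : Walk G u v) → u ∈ vertices p
  start∈vertices nil        = here refl
  start∈vertices (cons _ p) = here refl

  end∈vertices : (p : Walk G u v) → v ∈ vertices p
  end∈vertices nil        = here refl
  end∈vertices (cons _ p) = there (end∈vertices p)

  ∈edges⇒∈vertices : (p : Walk G u v) → (x , y) ∈ edges G p → x ∈ vertices p × y ∈ vertices p
  ∈edges⇒∈vertices (cons a p) (here refl) = here refl , there (start∈vertices p)
  ∈edges⇒∈vertices (cons a p) (there xy∈) = Product.map there there (∈edges⇒∈vertices p xy∈)

  ∈ⱽ-edges⇒∈vertices : (p : Walk G u v) → x ∈ⱽ edges G p → x ∈ vertices p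
  ∈ⱽ-edges⇒∈vertices (cons a p) (here (inj₁ refl)) = here refl
  ∈ⱽ-edges⇒∈vertices (cons a p) (here (inj₂ refl)) = there (start∈vertices p)
  ∈ⱽ-edges⇒∈vertices (cons a p) (there x∈)         = there (∈ⱽ-edges⇒∈vertices p x∈)

  ∈ⱽ-++-edges⁻ : ∀ es (p : Walk G u v) → x ∈ⱽ (es ++ edges G p) → x ∈ⱽ es ⊎ x ∈ vertices p
  ∈ⱽ-++-edges⁻ es p = Sum.map₂ (∈ⱽ-edges⇒∈vertices p) ∘ Any.++⁻ es

  splitAt : (p : Walk G u w) → x ∈ vertices p → Σ (Walk G u x) λ A → Σ (Walk G x w) λ B → p ≡ A ++ʷ B
  splitAt nil        (here refl) = nil , nil , refl
  splitAt (cons a p) (here refl) = nil , cons a p , refl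
  splitAt (cons a p) (there x∈)  with splitAt p x∈
  ... | A , B , refl = cons a A , B , refl

  ∈-vertices-++ʷ⁻ : (A : Walk G u v) (B : Walk G v w) → x ∈ vertices (A ++ʷ B) → x ∈ vertices A ⊎ x ∈ vertices B
  ∈-vertices-++ʷ⁻ nil        B x∈          = inj₂ x∈
  ∈-vertices-++ʷ⁻ (cons a A) B (here refl) = inj₁ (here refl)
  ∈-vertices-++ʷ⁻ (cons a A) B (there x∈)  = Sum.map₁ there (∈-vertices-++ʷ⁻ A B x∈)

  ∈-vertices-++ʷ⁺ˡ : (A : Walk G u v) (B : Walk G v w) → x ∈ vertices A → x ∈ vertices (A ++ʷ B)
  ∈-vertices-++ʷ⁺ˡ nil        B (here refl) = start∈vertices B
  ∈-vertices-++ʷ⁺ˡ (cons a A) B (here refl) = here refl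
  ∈-vertices-++ʷ⁺ˡ (cons a A) B (there x∈)  = there (∈-vertices-++ʷ⁺ˡ A B x∈)

  ∈-vertices-++ʷ⁺ʳ : (A : Walk G u v) (B : Walk G v w) → x ∈ vertices B → x ∈ vertices (A ++ʷ B)
  ∈-vertices-++ʷ⁺ʳ nil        B x∈ = x∈
  ∈-vertices-++ʷ⁺ʳ (cons a A) B x∈ = there (∈-vertices-++ʷ⁺ʳ A B x∈)

  rotate : (Z : Walk G u u) → x ∈ vertices Z →
           Σ (Walk G x x) λ Z′ → edges G Z′ ↭ edges G Z × vertices Z ⊆ⱽ vertices Z′
  rotate Z x∈ with splitAt Z x∈
  ... | A , B , refl = B ++ʷ A , edges↭ , vertices⊆
    where
    edges↭ : edges G (B ++ʷ A) ↭ edges G (A ++ʷ B)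
    edges↭ = begin
      edges G (B ++ʷ A)         ≡⟨ edges-++ʷ B A ⟩
      edges G B ++ edges G A    ↭⟨ ++-comm (edges G B) (edges G A) ⟩
      edges G A ++ edges G B    ≡⟨ edges-++ʷ A B ⟨
      edges G (A ++ʷ B)         ∎
      where open Permutation.PermutationReasoning edgeSetoid
    vertices⊆ : vertices (A ++ʷ B) ⊆ⱽ vertices (B ++ʷ A)
    vertices⊆ y∈ = Sum.[ ∈-vertices-++ʷ⁺ʳ B A , ∈-vertices-++ʷ⁺ˡ B A ] (∈-vertices-++ʷ⁻ A B y∈)

  IsPath : Walk G u v → Set
  IsPath p = PropositionalUnique.Unique (vertices p)

  path⇒trail : (p : Walk G u v) → IsPath p → IsTrail G p
  path⇒trail nil                _          = []
  path⇒trail (cons {u} {v} a p) (u∉ ∷ up) = All.tabulate uv≉ ∷ path⇒trail p up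
    where
    uv≉ : ∀ {f} → f ∈ edges G p → ¬ SameEdge G (u , v) f
    uv≉ {s , t} f∈ (inj₁ (refl , _)) = All.lookup u∉ (proj₁ (∈edges⇒∈vertices p f∈)) refl
    uv≉ {s , t} f∈ (inj₂ (refl , _)) = All.lookup u∉ (proj₂ (∈edges⇒∈vertices p f∈)) refl

  IsPath-suffix : (A : Walk G u x) (B : Walk G x w) → IsPath (A ++ʷ B) → IsPath B
  IsPath-suffix nil        B AB-path       = AB-path
  IsPath-suffix (cons a A) B (_ ∷ AB-path) = IsPath-suffix A B AB-path

  walk⇒path : (p : Walk G u w) → Σ (Walk G u w) λ q → IsPath q × edges G q ⊆ᴱ edges G p
  walk⇒path nil = nil , [] ∷ [] , id
  walk⇒path (cons {u} a p) with walk⇒path p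
  ... | q , q-path , q⊆p with u ∈? vertices q
  ... | yes u∈q with splitAt q u∈q
  ...   | A , B , refl = B , IsPath-suffix A B q-path , there ∘ q⊆p ∘ ⊆-++ʷʳ A B
  walk⇒path (cons {u} a p) | q , q-path , q⊆p | no u∉q =
    cons a q , ∉⇒All[≉] (setoid (V G)) u∉q ∷ q-path , ∷⁺ʳ edgeSetoid _ q⊆p

  closedPath⇒len≡0 : (p : Walk G u u) → IsPath p → len G p ≡ 0
  closedPath⇒len≡0 nil        _         = refl
  closedPath⇒len≡0 (cons a p) (u∉ ∷ _) = contradiction refl (All.lookup u∉ (end∈vertices p))

  path∋endsEdge⇒len≡1 : (p : Walk G u v) → IsPath p → (u , v) ∈ edges G p → len G p ≡ 1
  path∋endsEdge⇒len≡1 (cons a p) (_  ∷ p-path) (here refl) = cong suc (closedPath⇒len≡0 p p-path)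
  path∋endsEdge⇒len≡1 (cons a p) (u∉ ∷ _)      (there uv∈) =
    contradiction refl (All.lookup u∉ (proj₁ (∈edges⇒∈vertices p uv∈)))

  vertices≡initVerts∷ʳ : (p : Walk G u v) → vertices p ≡ initVerts G p ++ [ v ]
  vertices≡initVerts∷ʳ nil        = refl
  vertices≡initVerts∷ʳ (cons a p) = cong (_ ∷_) (vertices≡initVerts∷ʳ p)

  ∈edges⇒∈initVerts : (p : Walk G u v) → (x , y) ∈ edges G p → x ∈ initVerts G p
  ∈edges⇒∈initVerts (cons a p) (here refl) = here refl
  ∈edges⇒∈initVerts (cons a p) (there xy∈) = there (∈edges⇒∈initVerts p xy∈)

  -- The closing edge uv of the cycle could only repeat an edge of the path P from v back to u
  -- if P were the single edge vu, which length ≥ 3 excludes.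
  cycle⇒trail : (C : Walk G u u) → IsCycle G C → IsTrail G C
  cycle⇒trail nil (() , _)
  cycle⇒trail {u} (cons {_} {v} a P) (3≤len , u∉ ∷ distinct) = All.tabulate uv≉ ∷ path⇒trail P P-path
    where
    P-path : IsPath P
    P-path = subst PropositionalUnique.Unique (sym (vertices≡initVerts∷ʳ P))
               (AllPairsProperties.++⁺ distinct ([] ∷ []) (All.map (λ u≢x → (u≢x ∘ sym) ∷ []) u∉))
    uv≉ : ∀ {f} → f ∈ edges G P → ¬ SameEdge G (u , v) f
    uv≉ {s , t} f∈ (inj₁ (refl , _))    = All.lookup u∉ (∈edges⇒∈initVerts P f∈) refl
    uv≉ {s , t} f∈ (inj₂ (refl , refl)) =
      contradiction (subst (λ k → 3 ≤ suc k) (path∋endsEdge⇒len≡1 P P-path f∈) 3≤len) λ { (s≤s (s≤s ())) }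

  cycle⇒start∈ⱽ : (C : Walk G u u) → IsCycle G C → u ∈ⱽ edges G C
  cycle⇒start∈ⱽ nil        (() , _)
  cycle⇒start∈ⱽ (cons a C) _ = here (inj₁ refl)

  TrailIn : List (Edge G) → Parity → V G → V G → Set
  TrailIn es π x y = Σ (Walk G x y) λ T → IsTrail G T × edges G T ⊆ᴱ es × parityʷ T ≡ π

  trail⇒TrailIn : ∀ {π} (T : Walk G x y) → IsTrail G T → parityʷ T ≡ π → TrailIn (edges G T) π x y
  trail⇒TrailIn T t πT = T , t , id , πT

  TrailIn-mono : ∀ {es fs π} → es ⊆ᴱ fs → TrailIn es π x y → TrailIn fs π x y
  TrailIn-mono es⊆fs (T , t , T⊆es , πT) = T , t , es⊆fs ∘ T⊆es , πT

  TrailIn-reverse : ∀ {es π} → TrailIn es π x y → TrailIn es π y x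
  TrailIn-reverse (T , t , T⊆es , πT) =
    reverseʷ T , reverseʷ-trail T t , T⊆es ∘ ∈-resp-↭ (edges-reverseʷ T) ,
    trans (parityʷ-↭ (reverseʷ T) T (edges-reverseʷ T)) πT

  TrailIn-++ : ∀ {es fs π ρ} → TrailIn es π x y → TrailIn fs ρ y z → Disjoint es fs →
               TrailIn (es ++ fs) (π + ρ) x z
  TrailIn-++ (T , tT , T⊆es , πT) (T′ , tT′ , T′⊆fs , πT′) es#fs =
    T ++ʷ T′ ,
    ++ʷ-trail T T′ tT tT′ (λ (f∈T , f∈T′) → es#fs (T⊆es f∈T , T′⊆fs f∈T′)) ,
    ++ʷ-⊆ T T′ T⊆es T′⊆fs ,
    trans (parityʷ-++ʷ T T′) (cong₂ _+_ πT πT′)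

  trail⇒TrailIn-toEnd : (P : Walk G u v) → IsTrail G P → x ∈ vertices P → ∃ λ ρ → TrailIn (edges G P) ρ x v
  trail⇒TrailIn-toEnd P tP x∈ with splitAt P x∈
  ... | A , B , refl = parityʷ B , TrailIn-mono (⊆-++ʷʳ A B) (trail⇒TrailIn B (proj₁ (proj₂ (++ʷ-trail⁻ A B tP))) refl)

  oddClosedTrail⇒TrailIn : (Z : Walk G u u) → IsTrail G Z → parityʷ Z ≡ 1ℙ →
                           x ∈ vertices Z → y ∈ vertices Z → ∀ π → TrailIn (edges G Z) π x y
  oddClosedTrail⇒TrailIn Z tZ odd x∈ y∈ π with rotate Z x∈
  ... | Z′ , Z′↭Z , Z⊆Z′ with splitAt Z′ (Z⊆Z′ y∈)
  ... | P , Q , refl with ++ʷ-trail⁻ P Q (Unique-resp-↭ (↭-sym Z′↭Z) tZ)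
  ... | tP , tQ , _ with p+q≡1ℙ⇒p≡r⊎q≡r (parityʷ P) (parityʷ Q) π P+Q≡1ℙ
    where
    P+Q≡1ℙ : parityʷ P + parityʷ Q ≡ 1ℙ
    P+Q≡1ℙ = trans (sym (parityʷ-++ʷ P Q)) (trans (parityʷ-↭ (P ++ʷ Q) Z Z′↭Z) odd)
  ... | inj₁ πP = TrailIn-mono (∈-resp-↭ Z′↭Z ∘ ⊆-++ʷˡ P Q) (trail⇒TrailIn P tP πP)
  ... | inj₂ πQ = TrailIn-reverse (TrailIn-mono (∈-resp-↭ Z′↭Z ∘ ⊆-++ʷʳ P Q) (trail⇒TrailIn Q tQ πQ))

  ParityConnected : List (Edge G) → Set
  ParityConnected es = ∀ {x y} → x ∈ⱽ es → y ∈ⱽ es → ∀ π → TrailIn es π x y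

  oddClosedTrail⇒ParityConnected : (Z : Walk G u u) → IsTrail G Z → parityʷ Z ≡ 1ℙ → ParityConnected (edges G Z)
  oddClosedTrail⇒ParityConnected Z tZ odd x∈ y∈ =
    oddClosedTrail⇒TrailIn Z tZ odd (∈ⱽ-edges⇒∈vertices Z x∈) (∈ⱽ-edges⇒∈vertices Z y∈)

  record Ear (es : List (Edge G)) (u : V G) : Set where
    constructor ear
    field
      {end}    : V G
      walk     : Walk G u end
      start∈   : u ∈ⱽ es
      end∈     : end ∈ⱽ es
      trail    : IsTrail G walk
      disjoint : Disjoint (edges G walk) es

  closeEar : ∀ {L} (E : Ear L u) → ParityConnected L → ∀ π →
             Σ (Walk G (Ear.end E) u) λ T →
               IsTrail G (Ear.walk E ++ʷ T) × parityʷ (Ear.walk E ++ʷ T) ≡ parityʷ (Ear.walk E) + π × edges G T ⊆ᴱ L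
  closeEar (ear P u∈ v∈ tP P#L) conn π with conn v∈ u∈ π
  ... | T , tT , T⊆L , πT =
    T , ++ʷ-trail P T tP tT (λ (f∈P , f∈T) → P#L (f∈P , T⊆L f∈T)) ,
    trans (parityʷ-++ʷ P T) (cong (parityʷ P +_) πT) , T⊆L

  earVertex⇒TrailIn : ∀ {L} → ParityConnected L → (E : Ear L u) → x ∈ vertices (Ear.walk E) → y ∈ⱽ L →
                      ∀ π → TrailIn (L ++ edges G (Ear.walk E)) π x y
  earVertex⇒TrailIn {L = L} conn (ear P _ v∈ tP P#L) x∈P y∈L π with trail⇒TrailIn-toEnd P tP x∈P
  ... | ρ , B = subst (λ σ → TrailIn _ σ _ _) (p+[p+q]≡q ρ π)
                  (TrailIn-mono (∈-resp-↭ (++-comm (edges G P) L)) (TrailIn-++ B (conn v∈ y∈L (ρ + π)) P#L))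

  addEar : ∀ {L} → ParityConnected L → (E : Ear L u) → ParityConnected (L ++ edges G (Ear.walk E))
  addEar {L = L} conn E@(ear P _ _ _ _) x∈ y∈ π with ∈ⱽ-++-edges⁻ L P x∈ | ∈ⱽ-++-edges⁻ L P y∈
  ... | inj₁ x∈L | inj₁ y∈L = TrailIn-mono (xs⊆xs++ys edgeSetoid L _) (conn x∈L y∈L π)
  ... | inj₂ x∈P | inj₁ y∈L = earVertex⇒TrailIn conn E x∈P y∈L π
  ... | inj₁ x∈L | inj₂ y∈P = TrailIn-reverse (earVertex⇒TrailIn conn E y∈P x∈L π)
  ... | inj₂ x∈P | inj₂ y∈P with closeEar E conn (parityʷ P ⁻¹)
  ... | T , tZ , πZ , T⊆L =
    TrailIn-mono (∈-resp-↭ (++-comm (edges G P) L) ∘ ++ʷ-⊆ P T id T⊆L)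
      (oddClosedTrail⇒TrailIn (P ++ʷ T) tZ (trans πZ (p+p⁻¹≡1ℙ (parityʷ P)))
        (∈-vertices-++ʷ⁺ˡ P T x∈P) (∈-vertices-++ʷ⁺ˡ P T y∈P) π)

  prefixToFirstVisit : ∀ L (p : Walk G u w) → w ∈ⱽ L →
    Σ (V G) λ v → Σ (Walk G u v) λ P → v ∈ⱽ L × edges G P ⊆ᴱ edges G p × Disjoint (edges G P) L
  prefixToFirstVisit L nil w∈ = _ , nil , w∈ , id , λ { (() , _) }
  prefixToFirstVisit {u} L (cons a p) w∈ with u ∈ⱽ? L
  ... | yes u∈ = u , nil , u∈ , (λ ()) , λ { (() , _) }
  ... | no u∉ with prefixToFirstVisit L p w∈
  ... | v , P , v∈ , P⊆p , P#L = v , cons a P , v∈ , ∷⁺ʳ edgeSetoid _ P⊆p , ∷-disjoint (u∉ ∘ ∈ᴱ⇒proj₁∈ⱽ) P#L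

  earThrough : ∀ {L} → TwoEdgeConnected G → x ∈ⱽ L → (xw : Adj G x w) → (x , w) ∉ᴱ L →
               Σ (Ear L x) λ E → (x , w) ∈ᴱ edges G (Ear.walk E)
  earThrough {x} {w} {L} (_ , bridgeless) x∈ xw xw∉L with bridgeless (x , w) xw w x
  ... | P₀ , P₀-avoids with prefixToFirstVisit L P₀ x∈
  ... | v , P₁ , v∈ , P₁⊆P₀ , P₁#L with walk⇒path P₁
  ... | P , P-path , P⊆P₁ =
    ear (cons xw P) x∈ v∈ (∉⇒All[≉] edgeSetoid xw∉P ∷ path⇒trail P P-path)
        (∷-disjoint xw∉L (P₁#L ∘ Product.map₁ P⊆P₁)) ,
    here ≈-refl
    where
    xw∉P : (x , w) ∉ᴱ edges G P
    xw∉P = All[≉]⇒∉ edgeSetoid P₀-avoids ∘ P₁⊆P₀ ∘ P⊆P₁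

  EvenCircuitThrough : Edge G → Set
  EvenCircuitThrough e = Σ (V G) λ u → Σ (Walk G u u) λ W → IsCircuit G W × (2 ∣ len G W) × OnWalk G e W

  ear⇒EvenCircuitThrough : ∀ {L e} → ParityConnected L → (E : Ear L u) → e ∈ᴱ edges G (Ear.walk E) →
                           EvenCircuitThrough e
  ear⇒EvenCircuitThrough conn E@(ear P _ _ _ _) e∈P with closeEar E conn (parityʷ P)
  ... | T , tZ , πZ , _ = _ , P ++ʷ T , tZ , parity≡0ℙ⇒2∣ _ (trans πZ (p+p≡0ℙ (parityʷ P))) , ⊆-++ʷˡ P T e∈P

  evenCircuitThrough : ∀ {a b L} → TwoEdgeConnected G → Adj G a b → ParityConnected L → (a , b) ∉ᴱ L →
                       x ∈ⱽ L → Walk G x a → EvenCircuitThrough (a , b)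
  evenCircuitThrough tec ab conn ab∉L x∈ nil with earThrough tec x∈ ab ab∉L
  ... | E , ab∈E = ear⇒EvenCircuitThrough conn E ab∈E
  evenCircuitThrough {a = a} {b} {L} tec ab conn ab∉L x∈ (cons {_} {w} xw R) with w ∈ⱽ? L
  ... | yes w∈ = evenCircuitThrough tec ab conn ab∉L w∈ R
  ... | no w∉ with earThrough tec x∈ xw (w∉ ∘ ∈ᴱ⇒proj₂∈ⱽ)
  ... | E , xw∈E with (a , b) ∈ᴱ? edges G (Ear.walk E)
  ... | yes ab∈E = ear⇒EvenCircuitThrough conn E ab∈E
  ... | no ab∉E  = evenCircuitThrough tec ab (addEar conn E) (Sum.[ ab∉L , ab∉E ] ∘ Any.++⁻ L)
                                      (Any.++⁺ʳ L (∈ᴱ⇒proj₂∈ⱽ xw∈E)) R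

theorem6 : (G : Graph) → TwoEdgeConnected G → ∀ {c} (C : Walk G c c) → IsCycle G C → ¬ (2 ∣ len G C) → (e : Edge G) → IsEdge G e → ¬ OnWalk G e C → Σ (V G) λ u → Σ (Walk G u u) λ W → IsCircuit G W × (2 ∣ len G W) × OnWalk G e W
theorem6 G tec@(connected , _) {c} C cycle odd (a , b) ab ab∉C =
  evenCircuitThrough G tec ab C-parityConnected ab∉C (cycle⇒start∈ⱽ G C cycle) (connected c a)
  where
  C-parityConnected : ParityConnected G (edges G C)
  C-parityConnected = oddClosedTrail⇒ParityConnected G C (cycle⇒trail G C cycle) (¬2∣⇒parity≡1ℙ (len G C) odd)
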